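{- Let $H_n$ be a $2$-connected maximal outerplanar graph with $n$ vertices and diameter $3$. Then $H_n$ contains a vertex-induced subgraph isomorphic to $G_6^1$ or to $G_6^2$, where $G_6^1$ and $G_6^2$ are the following graphs on vertex set $\{v_0,v_1,\dots,v_5\}$: \begin{itemize} \item $G_6^1$ has edge set $\{v_0v_2,v_0v_3,v_2v_3,\ v_0v_1,v_1v_2,\ v_0v_4,v_4v_3,\ v_2v_5,v_5v_3\}$ (a triangle $v_0v_2v_3$ with a further vertex adjacent to both ends of each of its three edges); \item $G_6^2$ has edge set $\{v_0v_1,v_0v_2,v_0v_3,v_0v_4,\ v_1v_2,v_2v_3,v_3v_4,\ v_3v_5,v_4v_5\}$ (the fan with center $v_0$ over the path $v_1v_2v_3v_4$, together with a vertex $v_5$ adjacent to $v_3$ and $v_4$). \end{itemize}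
   Context: All graphs are finite, simple and undirected. An outerplanar graph is a graph that can be drawn in the plane without edge crossings so that all vertices lie on the boundary of the outer face. A maximal outerplanar graph is an outerplanar graph such that adding any edge between two nonadjacent vertices yields a graph that is not outerplanar. The diameter of a connected graph is the maximum distance between two of its vertices. -}

module Defs where

open import Data.Nat using (ℕ; zero; suc; _≤_; _<_)
open import Data.Fin using (Fin; toℕ; zero; suc) renaming (_≟_ to _≟ᶠ_)
open import Data.Unit using (⊤)
open import Data.Bool.Properties using (∨-comm)
open import Relation.Binary.PropositionalEquality using (refl; cong₂)
open import Data.Bool using (Bool; true; false; _∧_; _∨_)
open import Data.List using (List; []; _∷_)
open import Data.Bool.ListAction using (any)
open import Data.Product using (Σ; ∃; ∃-syntax; _×_; _,_)
open import Relation.Binary.PropositionalEquality using (_≡_; _≢_)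
open import Relation.Nullary using (¬_; does)
open import Function.Definitions using (Injective)

Adj : ℕ → Set
Adj n = Fin n → Fin n → Bool

record Graph (n : ℕ) : Set where
  field
    adj     : Adj n
    symm    : ∀ u v → adj u v ≡ adj v u
    irrefl  : ∀ u → adj u u ≡ false
open Graph public

Edge : ∀ {n} → Adj n → Fin n → Fin n → Set
Edge A u v = A u v ≡ true

data WalkIn {n} (A : Adj n) (P : Fin n → Set) : Fin n → Fin n → ℕ → Set where
  here : ∀ {u} → P u → WalkIn A P u u 0
  step : ∀ {u w v k} → P u → Edge A u w → WalkIn A P w v k → WalkIn A P u v (suc k)

Walk : ∀ {n} → Adj n → Fin n → Fin n → ℕ → Set
Walk A u v k = WalkIn A (λ _ → ⊤) u v k

DistLe : ∀ {n} → Graph n → Fin n → Fin n → ℕ → Set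
DistLe G u v d = ∃[ k ] (k ≤ d × Walk (adj G) u v k)

Connected : ∀ {n} → Graph n → Set
Connected G = ∀ u v → ∃[ k ] Walk (adj G) u v k

ConnectedWithout : ∀ {n} → Graph n → Fin n → Set
ConnectedWithout G x = ∀ u v → u ≢ x → v ≢ x →
  ∃[ k ] WalkIn (adj G) (λ w → w ≢ x) u v k

TwoConnected : ∀ {n} → Graph n → Set
TwoConnected {n} G = (3 ≤ n) × Connected G × (∀ x → ConnectedWithout G x)

Diameter3 : ∀ {n} → Graph n → Set
Diameter3 G = Connected G
  × (∀ u v → DistLe G u v 3)
  × (∃[ u ] ∃[ v ] ¬ DistLe G u v 2)

-- Outerplanarity (combinatorial: vertices placed on a circle in a cyclic
-- order given by an injective position map σ, edges drawn as chords,
-- no two chords cross)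

Crossing : ∀ {n} → (Fin n → Fin n) → Fin n → Fin n → Fin n → Fin n → Set
Crossing σ a b c d =
  toℕ (σ a) < toℕ (σ c) × toℕ (σ c) < toℕ (σ b) × toℕ (σ b) < toℕ (σ d)

OuterplanarAdj : ∀ {n} → Adj n → Set
OuterplanarAdj {n} A = Σ (Fin n → Fin n) λ σ → Injective _≡_ _≡_ σ ×
  (∀ a b c d → Edge A a b → Edge A c d → ¬ Crossing σ a b c d)

Outerplanar : ∀ {n} → Graph n → Set
Outerplanar G = OuterplanarAdj (adj G)

addEdge : ∀ {n} → Adj n → Fin n → Fin n → Adj n
addEdge A u v x y =
  A x y ∨ ((does (x ≟ᶠ u) ∧ does (y ≟ᶠ v)) ∨ (does (x ≟ᶠ v) ∧ does (y ≟ᶠ u)))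

MaximalOuterplanar : ∀ {n} → Graph n → Set
MaximalOuterplanar G = Outerplanar G ×
  (∀ u v → u ≢ v → adj G u v ≡ false → ¬ OuterplanarAdj (addEdge (adj G) u v))

HasInducedCopy : ∀ {n m} → Graph n → Graph m → Set
HasInducedCopy {n} {m} G H = Σ (Fin m → Fin n) λ f → Injective _≡_ _≡_ f ×
  (∀ i j → adj G (f i) (f j) ≡ adj H i j)

v0 v1 v2 v3 v4 v5 : Fin 6
v0 = zero
v1 = suc zero
v2 = suc (suc zero)
v3 = suc (suc (suc zero))
v4 = suc (suc (suc (suc zero)))
v5 = suc (suc (suc (suc (suc zero))))

data Pair : Set where
  _─_ : Fin 6 → Fin 6 → Pair

adjFromList : List Pair → Adj 6
adjFromList es x y = any match es
  where
  match : Pair → Bool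
  match (a ─ b) = (does (a ≟ᶠ x) ∧ does (b ≟ᶠ y)) ∨ (does (a ≟ᶠ y) ∧ does (b ≟ᶠ x))

G61-edges : List Pair
G61-edges = (v0 ─ v2) ∷ (v0 ─ v3) ∷ (v2 ─ v3) ∷ (v0 ─ v1) ∷ (v1 ─ v2)
          ∷ (v0 ─ v4) ∷ (v4 ─ v3) ∷ (v2 ─ v5) ∷ (v5 ─ v3) ∷ []

G62-edges : List Pair
G62-edges = (v0 ─ v1) ∷ (v0 ─ v2) ∷ (v0 ─ v3) ∷ (v0 ─ v4) ∷ (v1 ─ v2)
          ∷ (v2 ─ v3) ∷ (v3 ─ v4) ∷ (v3 ─ v5) ∷ (v4 ─ v5) ∷ []

adjFromList-symm : ∀ es u v → adjFromList es u v ≡ adjFromList es v u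
adjFromList-symm [] u v = refl
adjFromList-symm ((a ─ b) ∷ es) u v =
  cong₂ _∨_ (∨-comm (does (a ≟ᶠ u) ∧ does (b ≟ᶠ v)) (does (a ≟ᶠ v) ∧ does (b ≟ᶠ u)))
            (adjFromList-symm es u v)

irrefl61 : ∀ u → adjFromList G61-edges u u ≡ false
irrefl61 zero = refl
irrefl61 (suc zero) = refl
irrefl61 (suc (suc zero)) = refl
irrefl61 (suc (suc (suc zero))) = refl
irrefl61 (suc (suc (suc (suc zero)))) = refl
irrefl61 (suc (suc (suc (suc (suc zero))))) = refl

irrefl62 : ∀ u → adjFromList G62-edges u u ≡ false
irrefl62 zero = refl
irrefl62 (suc zero) = refl
irrefl62 (suc (suc zero)) = refl
irrefl62 (suc (suc (suc zero))) = refl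
irrefl62 (suc (suc (suc (suc zero)))) = refl
irrefl62 (suc (suc (suc (suc (suc zero))))) = refl

G61 : Graph 6
G61 = record { adj = adjFromList G61-edges ; symm = adjFromList-symm G61-edges ; irrefl = irrefl61 }

G62 : Graph 6
G62 = record { adj = adjFromList G62-edges ; symm = adjFromList-symm G62-edges ; irrefl = irrefl62 }

{-# OPTIONS --safe #-}
module Submission where

open import Defs
open import Data.Nat using (ℕ; zero; suc; _+_; _∸_; _≤_; _<_; _≤?_; _<?_; _<ᵇ_; z≤n; s≤s; s≤s⁻¹; z<s)
open import Data.Nat.Properties
  using (≤-refl; ≤-reflexive; ≤-trans; <-trans; <-≤-trans; ≤-<-trans; <⇒≤; <⇒≱; ≰⇒>; <-irrefl; <-asym;
         <-cmp; ≤∧≢⇒<; <⇒<ᵇ; m≤n⇒m<n∨m≡n; n<1+n; n≢0⇒n>0; m≤n+m; m∸n≤m; n∸n≡0; ∸-monoˡ-<; +-monoˡ-<;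
         m+n∸n≡m; m+[n∸m]≡n; m∸n+n≡m; m∸[m∸n]≡n)
open import Data.Fin using (Fin; zero; suc; toℕ; fromℕ<; punchOut; _≟_)
import Data.Fin.Properties as Fin
open import Data.Bool using (true; false; T; _∧_; if_then_else_)
open import Data.Bool.Properties using (¬-not; T-≡; T-∨) renaming (_≟_ to _≟ᵇ_)
open import Data.Unit using (tt)
open import Data.Empty using (⊥)
open import Data.Product using (∃; ∃-syntax; ∃₂; _×_; _,_; proj₁; proj₂)
open import Data.Sum using (_⊎_; inj₁; inj₂; [_,_]′)
import Data.Sum as Sum
open import Function using (_∘_; case_of_)
open import Function.Bundles using (module Equivalence)
open import Function.Definitions using (Injective)
open import Relation.Nullary using (¬_; Dec; yes; no; does; ¬?; contradiction)
open import Relation.Nullary.Decidable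
  using (dec-true; dec-false; decidable-stable; from-yes; _×-dec_; _⊎-dec_)
open import Relation.Unary using (Pred; Decidable)
open import Relation.Binary using (tri<; tri≈; tri>)
open import Relation.Binary.PropositionalEquality
  using (_≡_; _≢_; refl; sym; trans; cong; subst; subst₂; module ≡-Reasoning)

open Equivalence using (to; from)

-- Number the vertices 0, …, N along the outer cycle, starting at u.  The edges are then chords
-- of a polygon that pairwise do not cross, and every non-edge is crossed by one; hence
-- consecutive neighbours of a vertex are adjacent, and every chord ij with i + 1 < j carries a
-- triangle ikj with i < k < j.  If v is at distance at least 3 from u, it lies strictly between
-- consecutive neighbours a < b of u; let abc be the triangle on ab.  Say v lies under ac (the
-- case cb is mirror-symmetric).  Then v lies strictly between consecutive neighbours s < t of a,
-- the triangle on st gives a vertex x, and a is the centre of a fan over s, t and the next two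
-- neighbours of a after t (the second may be u); these six vertices induce G₆².

least : ∀ {p} {P : Pred ℕ p} → Decidable P → ∀ {j} → P j →
        ∃[ m ] m ≤ j × P m × (∀ {k} → k < m → ¬ P k)
least P? {zero} Pj = 0 , z≤n , Pj , λ ()
least P? {suc j} Pj with P? 0
... | yes P0 = 0 , z≤n , P0 , λ ()
... | no ¬P0 with least (λ k → P? (suc k)) Pj
...   | m , m≤j , Pm , below =
  suc m , s≤s m≤j , Pm , λ { {zero} _ → ¬P0 ; {suc k} k<m → below (s≤s⁻¹ k<m) }

least-above : ∀ {p} {P : Pred ℕ p} → Decidable P → ∀ {a j} → a < j → P j →
              ∃[ m ] a < m × m ≤ j × P m × (∀ {k} → a < k → k < m → ¬ P k)
least-above P? {a} a<j Pj with least (λ k → a <? k ×-dec P? k) (a<j , Pj)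
... | m , m≤j , (a<m , Pm) , below = m , a<m , m≤j , Pm , λ a<k k<m Pk → below k<m (a<k , Pk)

greatest-below : ∀ {p} {P : Pred ℕ p} → Decidable P → ∀ {j b} → j < b → P j →
                 ∃[ m ] j ≤ m × m < b × P m × (∀ {k} → m < k → k < b → ¬ P k)
greatest-below P? {j} {suc b} j<1+b Pj with P? b
... | yes Pb = b , s≤s⁻¹ j<1+b , n<1+n b , Pb , λ b<k k<1+b _ → <⇒≱ b<k (s≤s⁻¹ k<1+b)
... | no ¬Pb with m≤n⇒m<n∨m≡n (s≤s⁻¹ j<1+b)
...   | inj₂ refl = contradiction Pj ¬Pb
...   | inj₁ j<b with greatest-below P? j<b Pj
...     | m , j≤m , m<b , Pm , above = m , j≤m , <-trans m<b (n<1+n b) , Pm , λ {k} m<k k<1+b →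
          [ (λ k<b → above m<k k<b) , (λ { refl → ¬Pb }) ]′ (m≤n⇒m<n∨m≡n (s≤s⁻¹ k<1+b))

Ascending : ℕ → ℕ → ℕ → ℕ → Set
Ascending a b c d = a < b × b < c × c < d

Cyclic : ℕ → ℕ → ℕ → ℕ → Set
Cyclic a b c d = Ascending a b c d ⊎ Ascending b c d a ⊎ Ascending c d a b ⊎ Ascending d a b c

Cyclic-rotate : ∀ {a b c d} → Cyclic a b c d → Cyclic b c d a
Cyclic-rotate (inj₁ abcd) = inj₂ (inj₂ (inj₂ abcd))
Cyclic-rotate (inj₂ (inj₁ bcda)) = inj₁ bcda
Cyclic-rotate (inj₂ (inj₂ (inj₁ cdab))) = inj₂ (inj₁ cdab)
Cyclic-rotate (inj₂ (inj₂ (inj₂ dabc))) = inj₂ (inj₂ (inj₁ dabc))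

Cyclic-resp : ∀ {a b c d a′ b′ c′ d′} → a ≡ a′ → b ≡ b′ → c ≡ c′ → d ≡ d′ →
              Cyclic a b c d → Cyclic a′ b′ c′ d′
Cyclic-resp refl refl refl refl abcd = abcd

Cyclic⇒inside : ∀ {a b c d} → Cyclic a c b d → a < b → a < c × c < b × (d < a ⊎ b < d)
Cyclic⇒inside (inj₁ (a<c , c<b , b<d)) _ = a<c , c<b , inj₂ b<d
Cyclic⇒inside (inj₂ (inj₁ (_ , b<d , d<a))) a<b = contradiction (<-trans b<d d<a) (<-asym a<b)
Cyclic⇒inside (inj₂ (inj₂ (inj₁ (b<d , d<a , _)))) a<b = contradiction (<-trans b<d d<a) (<-asym a<b)
Cyclic⇒inside (inj₂ (inj₂ (inj₂ (d<a , a<c , c<b)))) _ = a<c , c<b , inj₁ d<a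

-- x ∸ s modulo n (for s ≤ n and x < n): the circle of positions turned so that s comes to 0.
rotate : ℕ → ℕ → ℕ → ℕ
rotate n s x = if does (s ≤? x) then x ∸ s else x + (n ∸ s)

module _ (n : ℕ) where

  rotate-≥ : ∀ {s x} → s ≤ x → rotate n s x ≡ x ∸ s
  rotate-≥ {s} {x} s≤x rewrite dec-true (s ≤? x) s≤x = refl

  rotate-< : ∀ {s x} → x < s → rotate n s x ≡ x + (n ∸ s)
  rotate-< {s} {x} x<s rewrite dec-false (s ≤? x) (<⇒≱ x<s) = refl

  rotate-self : ∀ s → rotate n s s ≡ 0
  rotate-self s = trans (rotate-≥ (≤-refl {s})) (n∸n≡0 s)

  rotate-bounded : ∀ {s} → s ≤ n → ∀ {x} → x < n → rotate n s x < n
  rotate-bounded {s} Pu≤n {x} x<n with s ≤? x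
  ... | yes s≤x rewrite rotate-≥ s≤x = ≤-<-trans (m∸n≤m x s) x<n
  ... | no s≰x rewrite rotate-< (≰⇒> s≰x) =
    <-≤-trans (+-monoˡ-< (n ∸ s) (≰⇒> s≰x)) (≤-reflexive (m+[n∸m]≡n Pu≤n))

  rotate-inverse : ∀ {s} → s ≤ n → ∀ {x} → x < n → rotate n (n ∸ s) (rotate n s x) ≡ x
  rotate-inverse {s} Pu≤n {x} x<n with s ≤? x
  ... | yes s≤x rewrite rotate-≥ s≤x
                      | rotate-< {s = n ∸ s} (∸-monoˡ-< x<n s≤x)
                      | m∸[m∸n]≡n Pu≤n = m∸n+n≡m s≤x
  ... | no s≰x rewrite rotate-< (≰⇒> s≰x)
                     | rotate-≥ {s = n ∸ s} (m≤n+m (n ∸ s) x) = m+n∸n≡m x (n ∸ s)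

  rotate-inverse′ : ∀ {s} → s ≤ n → ∀ {x} → x < n → rotate n s (rotate n (n ∸ s) x) ≡ x
  rotate-inverse′ {s} s≤n {x} x<n =
    subst (λ t → rotate n t (rotate n (n ∸ s) x) ≡ x) (m∸[m∸n]≡n s≤n) (rotate-inverse (m∸n≤m n s) x<n)

  rotate-mono-≥ : ∀ {s a b} → s ≤ a → a < b → rotate n s a < rotate n s b
  rotate-mono-≥ {s} {a} {b} s≤a a<b rewrite rotate-≥ s≤a | rotate-≥ (≤-trans s≤a (<⇒≤ a<b)) =
    ∸-monoˡ-< a<b s≤a

  rotate-mono-< : ∀ {s a b} → a < b → b < s → rotate n s a < rotate n s b
  rotate-mono-< {s} {a} {b} a<b b<s rewrite rotate-< (<-trans a<b b<s) | rotate-< b<s =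
    +-monoˡ-< (n ∸ s) a<b

  rotate-wraps : ∀ {s a b} → s ≤ a → a < n → b < s → rotate n s a < rotate n s b
  rotate-wraps {s} {a} {b} s≤a a<n b<s rewrite rotate-≥ s≤a | rotate-< b<s =
    <-≤-trans (∸-monoˡ-< a<n s≤a) (m≤n+m (n ∸ s) b)

  rotate-cyclic : ∀ s {x y z w} → x < y → y < z → z < w → w < n →
                  Cyclic (rotate n s x) (rotate n s y) (rotate n s z) (rotate n s w)
  rotate-cyclic s {x} {y} {z} {w} x<y y<z z<w w<n with s ≤? x | s ≤? y | s ≤? z | s ≤? w
  ... | yes s≤x | _ | _ | _ =
    inj₁ (rotate-mono-≥ s≤x x<y , rotate-mono-≥ s≤y y<z , rotate-mono-≥ s≤z z<w)
    where s≤y = ≤-trans s≤x (<⇒≤ x<y)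
          s≤z = ≤-trans s≤y (<⇒≤ y<z)
  ... | no s≰x | yes s≤y | _ | _ =
    inj₂ (inj₁ (rotate-mono-≥ s≤y y<z , rotate-mono-≥ s≤z z<w , rotate-wraps s≤w w<n (≰⇒> s≰x)))
    where s≤z = ≤-trans s≤y (<⇒≤ y<z)
          s≤w = ≤-trans s≤z (<⇒≤ z<w)
  ... | no s≰x | no s≰y | yes s≤z | _ =
    inj₂ (inj₂ (inj₁ (rotate-mono-≥ s≤z z<w , rotate-wraps s≤w w<n (≰⇒> s≰x) ,
                      rotate-mono-< x<y (≰⇒> s≰y))))
    where s≤w = ≤-trans s≤z (<⇒≤ z<w)
  ... | no s≰x | no s≰y | no s≰z | yes s≤w =
    inj₂ (inj₂ (inj₂ (rotate-wraps s≤w w<n (≰⇒> s≰x) , rotate-mono-< x<y (≰⇒> s≰y) ,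
                      rotate-mono-< y<z (≰⇒> s≰z))))
  ... | no _ | no s≰y | no s≰z | no s≰w =
    inj₁ (rotate-mono-< x<y (≰⇒> s≰y) , rotate-mono-< y<z (≰⇒> s≰z) , rotate-mono-< z<w (≰⇒> s≰w))
injective⇒surjective : ∀ {m} {f : Fin m → Fin m} → Injective _≡_ _≡_ f → ∀ y → ∃ λ a → f a ≡ y
injective⇒surjective {zero} _ ()
injective⇒surjective {suc m} {f} f-inj y with Fin.any? (λ a → f a ≟ y)
... | yes hit = hit
... | no miss = contradiction (λ {a} {b} → squeeze-injective {a} {b}) (Fin.<⇒notInjective (n<1+n m))
  where
  avoids : ∀ a → y ≢ f a
  avoids a y≡fa = miss (a , sym y≡fa)

  squeeze-injective : Injective _≡_ _≡_ (λ a → punchOut (avoids a))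
  squeeze-injective {a} {b} eq = f-inj (Fin.punchOut-injective (avoids a) (avoids b) eq)

-- A maximal outerplanar graph, with its vertices numbered 0, …, N along the outer cycle.
module TriangulatedPolygon
  (N : ℕ)
  (_~_ : ℕ → ℕ → Set)
  (_~?_ : ∀ i j → Dec (i ~ j))
  (~-sym : ∀ {i j} → i ~ j → j ~ i)
  (non-crossing : ∀ {i k j l} → i < k → k < j → j < l → l ≤ N → i ~ j → ¬ k ~ l)
  (saturated : ∀ {i j} → i < j → j ≤ N → ¬ i ~ j →
               ∃₂ λ k l → i < k × k < j × (l < i ⊎ j < l) × l ≤ N × k ~ l)
  where

  NoNeighbourBetween : ℕ → ℕ → ℕ → Set
  NoNeighbourBetween w a b = ∀ {c} → a < c → c < b → ¬ w ~ c

  boundary-edge : ∀ {i} → i < N → i ~ suc i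
  boundary-edge {i} i<N = decidable-stable (i ~? suc i) λ ¬i~1+i →
    let (_ , _ , i<k , k<1+i , _) = saturated (n<1+n i) i<N ¬i~1+i
    in <⇒≱ i<k (s≤s⁻¹ k<1+i)

  closing-edge : 0 < N → 0 ~ N
  closing-edge 0<N = decidable-stable (0 ~? N) λ ¬0~N →
    let (_ , _ , _ , _ , outside , l≤N , _) = saturated 0<N ≤-refl ¬0~N
    in [ (λ ()) , (λ N<l → <⇒≱ N<l l≤N) ]′ outside

  consecutive-neighbours-adjacent : ∀ {w a b} → a < b → b ≤ N → w ≤ N → (w < a ⊎ b < w) →
                                    w ~ a → w ~ b → NoNeighbourBetween w a b → a ~ b
  consecutive-neighbours-adjacent {w} {a} {b} a<b b≤N w≤N outside w~a w~b gap =
    decidable-stable (a ~? b) λ ¬a~b →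
      let (_ , _ , a<k , k<b , l-outside , l≤N , k~l) = saturated a<b b≤N ¬a~b
      in crosses outside l-outside a<k k<b l≤N k~l
    where
    crosses : ∀ {k l} → (w < a ⊎ b < w) → (l < a ⊎ b < l) → a < k → k < b → l ≤ N → k ~ l → ⊥
    crosses (inj₁ w<a) (inj₂ b<l) a<k k<b l≤N k~l =
      non-crossing (<-trans w<a a<k) k<b b<l l≤N w~b k~l
    crosses (inj₂ b<w) (inj₁ l<a) a<k k<b l≤N k~l =
      non-crossing l<a a<k (<-trans k<b b<w) w≤N (~-sym k~l) (~-sym w~a)
    crosses {k} {l} (inj₁ w<a) (inj₁ l<a) a<k k<b l≤N k~l with <-cmp l w
    ... | tri< l<w _ _ = non-crossing l<w (<-trans w<a a<k) k<b b≤N (~-sym k~l) w~b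
    ... | tri≈ _ refl _ = gap a<k k<b (~-sym k~l)
    ... | tri> _ _ w<l = non-crossing w<l l<a a<k (<⇒≤ (<-≤-trans k<b b≤N)) w~a (~-sym k~l)
    crosses {k} {l} (inj₂ b<w) (inj₂ b<l) a<k k<b l≤N k~l with <-cmp l w
    ... | tri< l<w _ _ = non-crossing k<b b<l l<w w≤N k~l (~-sym w~b)
    ... | tri≈ _ refl _ = gap a<k k<b (~-sym k~l)
    ... | tri> _ _ w<l = non-crossing a<k (<-trans k<b b<w) w<l l≤N (~-sym w~a) k~l

  apex : ∀ {i j} → suc i < j → j ≤ N → i ~ j → ∃[ k ] i < k × k < j × i ~ k × k ~ j
  apex {i} {j} 1+i<j j≤N i~j =
    let (k , i<k , k<j , i~k , gap) = greatest-below (i ~?_) 1+i<j (boundary-edge i<N)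
    in k , i<k , k<j , i~k , consecutive-neighbours-adjacent k<j j≤N (<⇒≤ i<N) (inj₁ i<k) i~k i~j gap
    where i<N = <-trans (n<1+n i) (<-≤-trans 1+i<j j≤N)

  flanking-neighbours : ∀ {w l p r} → w ≤ N → r ≤ N → (w < l ⊎ r < w) → l < p → p < r →
                        w ~ l → w ~ r → ¬ w ~ p →
                        ∃₂ λ s t → l ≤ s × s < p × p < t × t ≤ r × w ~ s × w ~ t × s ~ t
  flanking-neighbours {w} {l} {p} {r} w≤N r≤N outside l<p p<r w~l w~r ¬w~p
    with greatest-below (w ~?_) l<p w~l | least-above (w ~?_) p<r w~r
  ... | s , l≤s , s<p , w~s , none-below | t , p<t , t≤r , w~t , none-above =
    s , t , l≤s , s<p , p<t , t≤r , w~s , w~t ,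
    consecutive-neighbours-adjacent (<-trans s<p p<t) (≤-trans t≤r r≤N) w≤N outside′ w~s w~t gap
    where
    outside′ : w < s ⊎ t < w
    outside′ = Sum.map (λ w<l → <-≤-trans w<l l≤s) (λ r<w → ≤-<-trans t≤r r<w) outside

    gap : NoNeighbourBetween w s t
    gap {c} s<c c<t with <-cmp c p
    ... | tri< c<p _ _ = none-below s<c c<p
    ... | tri≈ _ refl _ = ¬w~p
    ... | tri> _ _ p<c = none-above p<c c<t

  next-neighbour-adjacent : ∀ {w t j} → w < t → j ≤ N → w ~ t → w ~ j → t < j →
                            ∃[ y ] t < y × y ≤ j × w ~ y × t ~ y
  next-neighbour-adjacent {w} w<t j≤N w~t w~j t<j =
    let (y , t<y , y≤j , w~y , gap) = least-above (w ~?_) t<j w~j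
        y≤N = ≤-trans y≤j j≤N
        w≤N = <⇒≤ (<-≤-trans (<-trans w<t t<y) y≤N)
    in y , t<y , y≤j , w~y , consecutive-neighbours-adjacent t<y y≤N w≤N (inj₁ w<t) w~t w~y gap

  previous-neighbour-adjacent : ∀ {w t j} → t < w → w ≤ N → w ~ t → w ~ j → j < t →
                                ∃[ y ] j ≤ y × y < t × w ~ y × y ~ t
  previous-neighbour-adjacent {w} t<w w≤N w~t w~j j<t =
    let (y , j≤y , y<t , w~y , gap) = greatest-below (w ~?_) j<t w~j
        t≤N = <⇒≤ (<-≤-trans t<w w≤N)
    in y , j≤y , y<t , w~y , consecutive-neighbours-adjacent y<t t≤N w≤N (inj₂ t<w) w~y w~t gap

  record FanWithEar : Set where
    constructor mkFanWithEar
    field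
      w y₁ y₂ y₃ y₄ x : ℕ
      w~y₁  : w ~ y₁
      w~y₂  : w ~ y₂
      w~y₃  : w ~ y₃
      w~y₄  : w ~ y₄
      y₁~y₂ : y₁ ~ y₂
      y₂~y₃ : y₂ ~ y₃
      y₃~y₄ : y₃ ~ y₄
      y₃~x  : y₃ ~ x
      y₄~x  : y₄ ~ x
      w≁x   : ¬ w ~ x
      y₁≁y₃ : ¬ y₁ ~ y₃
      y₁≁y₄ : ¬ y₁ ~ y₄
      y₁≁x  : ¬ y₁ ~ x
      y₂≁y₄ : ¬ y₂ ~ y₄
      y₂≁x  : ¬ y₂ ~ x

  -- Around the polygon the six vertices always lie in the cyclic order w, y₄, x, y₃, y₂, y₁;
  -- the three lemmas below are the linear orders of it that occur.  Each missing edge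
  -- would cross the chord wy₃, wy₂ or y₃y₄.

  fan-ascending : ∀ {w y₁ y₂ y₃ y₄ x} → y₁ < y₂ → y₂ < y₃ → y₃ < x → x < y₄ → y₄ < w → w ≤ N →
                  w ~ y₁ → w ~ y₂ → w ~ y₃ → w ~ y₄ → y₁ ~ y₂ → y₂ ~ y₃ → y₃ ~ y₄ → y₃ ~ x → y₄ ~ x →
                  FanWithEar
  fan-ascending {w} {y₁} {y₂} {y₃} {y₄} {x} y₁<y₂ y₂<y₃ y₃<x x<y₄ y₄<w w≤N
                w~y₁ w~y₂ w~y₃ w~y₄ y₁~y₂ y₂~y₃ y₃~y₄ y₃~x y₄~x =
    mkFanWithEar w y₁ y₂ y₃ y₄ x w~y₁ w~y₂ w~y₃ w~y₄ y₁~y₂ y₂~y₃ y₃~y₄ y₃~x y₄~x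
      (λ w~x → non-crossing y₃<x x<y₄ y₄<w w≤N y₃~y₄ (~-sym w~x))
      (λ y₁~y₃ → non-crossing y₁<y₂ y₂<y₃ y₃<w w≤N y₁~y₃ (~-sym w~y₂))
      (λ y₁~y₄ → non-crossing y₁<y₃ y₃<y₄ y₄<w w≤N y₁~y₄ (~-sym w~y₃))
      (λ y₁~x → non-crossing y₁<y₃ y₃<x x<w w≤N y₁~x (~-sym w~y₃))
      (λ y₂~y₄ → non-crossing y₂<y₃ y₃<y₄ y₄<w w≤N y₂~y₄ (~-sym w~y₃))
      (λ y₂~x → non-crossing y₂<y₃ y₃<x x<w w≤N y₂~x (~-sym w~y₃))
    where
    y₁<y₃ = <-trans y₁<y₂ y₂<y₃
    y₃<y₄ = <-trans y₃<x x<y₄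
    x<w = <-trans x<y₄ y₄<w
    y₃<w = <-trans y₃<y₄ y₄<w

  fan-descending : ∀ {w y₁ y₂ y₃ y₄ x} → w < y₄ → y₄ < x → x < y₃ → y₃ < y₂ → y₂ < y₁ → y₁ ≤ N →
                   w ~ y₁ → w ~ y₂ → w ~ y₃ → w ~ y₄ → y₁ ~ y₂ → y₂ ~ y₃ → y₃ ~ y₄ → y₃ ~ x → y₄ ~ x →
                   FanWithEar
  fan-descending {w} {y₁} {y₂} {y₃} {y₄} {x} w<y₄ y₄<x x<y₃ y₃<y₂ y₂<y₁ y₁≤N
                 w~y₁ w~y₂ w~y₃ w~y₄ y₁~y₂ y₂~y₃ y₃~y₄ y₃~x y₄~x =
    mkFanWithEar w y₁ y₂ y₃ y₄ x w~y₁ w~y₂ w~y₃ w~y₄ y₁~y₂ y₂~y₃ y₃~y₄ y₃~x y₄~x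
      (λ w~x → non-crossing w<y₄ y₄<x x<y₃ y₃≤N w~x (~-sym y₃~y₄))
      (λ y₁~y₃ → non-crossing w<y₃ y₃<y₂ y₂<y₁ y₁≤N w~y₂ (~-sym y₁~y₃))
      (λ y₁~y₄ → non-crossing w<y₄ y₄<y₃ y₃<y₁ y₁≤N w~y₃ (~-sym y₁~y₄))
      (λ y₁~x → non-crossing w<x x<y₃ y₃<y₁ y₁≤N w~y₃ (~-sym y₁~x))
      (λ y₂~y₄ → non-crossing w<y₄ y₄<y₃ y₃<y₂ y₂≤N w~y₃ (~-sym y₂~y₄))
      (λ y₂~x → non-crossing w<x x<y₃ y₃<y₂ y₂≤N w~y₃ (~-sym y₂~x))
    where
    w<x = <-trans w<y₄ y₄<x
    w<y₃ = <-trans w<x x<y₃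
    y₄<y₃ = <-trans y₄<x x<y₃
    y₃<y₁ = <-trans y₃<y₂ y₂<y₁
    y₂≤N = <⇒≤ (<-≤-trans y₂<y₁ y₁≤N)
    y₃≤N = <⇒≤ (<-≤-trans y₃<y₁ y₁≤N)

  fan-wrapped : ∀ {w y₁ y₂ y₃ y₄ x} → y₁ < w → w < y₄ → y₄ < x → x < y₃ → y₃ < y₂ → y₂ ≤ N →
                w ~ y₁ → w ~ y₂ → w ~ y₃ → w ~ y₄ → y₁ ~ y₂ → y₂ ~ y₃ → y₃ ~ y₄ → y₃ ~ x → y₄ ~ x →
                FanWithEar
  fan-wrapped {w} {y₁} {y₂} {y₃} {y₄} {x} y₁<w w<y₄ y₄<x x<y₃ y₃<y₂ y₂≤N
              w~y₁ w~y₂ w~y₃ w~y₄ y₁~y₂ y₂~y₃ y₃~y₄ y₃~x y₄~x =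
    mkFanWithEar w y₁ y₂ y₃ y₄ x w~y₁ w~y₂ w~y₃ w~y₄ y₁~y₂ y₂~y₃ y₃~y₄ y₃~x y₄~x
      (λ w~x → non-crossing w<y₄ y₄<x x<y₃ y₃≤N w~x (~-sym y₃~y₄))
      (λ y₁~y₃ → non-crossing y₁<w w<y₃ y₃<y₂ y₂≤N y₁~y₃ w~y₂)
      (λ y₁~y₄ → non-crossing y₁<w w<y₄ y₄<y₃ y₃≤N y₁~y₄ w~y₃)
      (λ y₁~x → non-crossing y₁<w w<x x<y₃ y₃≤N y₁~x w~y₃)
      (λ y₂~y₄ → non-crossing w<y₄ y₄<y₃ y₃<y₂ y₂≤N w~y₃ (~-sym y₂~y₄))
      (λ y₂~x → non-crossing w<x x<y₃ y₃<y₂ y₂≤N w~y₃ (~-sym y₂~x))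
    where
    w<x = <-trans w<y₄ y₄<x
    w<y₃ = <-trans w<x x<y₃
    y₄<y₃ = <-trans y₄<x x<y₃
    y₃≤N = <⇒≤ (<-≤-trans y₃<y₂ y₂≤N)

  fan-around-left-corner : ∀ {a b c p} → 0 < a → a < p → p < c → c < b → b ≤ N →
                           0 ~ a → 0 ~ b → a ~ b → a ~ c → ¬ a ~ p → FanWithEar
  fan-around-left-corner {a} {b} {c} {p} 0<a a<p p<c c<b b≤N 0~a 0~b a~b a~c ¬a~p =
    let (s , t , a<s , s<p , p<t , t≤c , a~s , a~t , s~t) =
          flanking-neighbours (<⇒≤ a<N) c≤N (inj₁ (n<1+n a)) 1+a<p p<c (boundary-edge a<N) a~c ¬a~p
        (x , s<x , x<t , s~x , x~t) = apex (≤-<-trans s<p p<t) (≤-trans t≤c c≤N) s~t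
        a<t = <-trans a<s (<-trans s<x x<t)
        (y₂ , t<y₂ , y₂≤b , a~y₂ , t~y₂) = next-neighbour-adjacent a<t b≤N a~t a~b (≤-<-trans t≤c c<b)
    in case m≤n⇒m<n∨m≡n y₂≤b of λ where
      (inj₂ y₂≡b) → fan-wrapped 0<a a<s s<x x<t t<y₂ (subst (_≤ N) (sym y₂≡b) b≤N)
                      (~-sym 0~a) a~y₂ a~t a~s (subst (0 ~_) (sym y₂≡b) 0~b)
                      (~-sym t~y₂) (~-sym s~t) (~-sym x~t) s~x
      (inj₁ y₂<b) →
        let (y₁ , y₂<y₁ , y₁≤b , a~y₁ , y₂~y₁) =
              next-neighbour-adjacent (<-trans a<t t<y₂) b≤N a~y₂ a~b y₂<b
        in fan-descending a<s s<x x<t t<y₂ y₂<y₁ (≤-trans y₁≤b b≤N)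
             a~y₁ a~y₂ a~t a~s (~-sym y₂~y₁) (~-sym t~y₂) (~-sym s~t) (~-sym x~t) s~x
    where
    a<N = <-≤-trans (<-trans a<p (<-trans p<c c<b)) b≤N
    c≤N = <⇒≤ (<-≤-trans c<b b≤N)
    1+a<p = ≤∧≢⇒< a<p λ 1+a≡p → ¬a~p (subst (a ~_) 1+a≡p (boundary-edge a<N))

  fan-around-right-corner : ∀ {a b c p} → 0 < a → a < c → c < p → p < b → b ≤ N →
                            b ~ 0 → b ~ a → b ~ c → ¬ b ~ p → FanWithEar
  fan-around-right-corner {a} {suc b′} {c} {p} 0<a a<c c<p p<b b≤N b~0 b~a b~c ¬b~p =
    let (s , t , c≤s , s<p , p<t , t≤b′ , b~s , b~t , s~t) =
          flanking-neighbours b≤N (<⇒≤ b′<N) (inj₂ (n<1+n b′)) c<p p<b′ b~c b~b′ ¬b~p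
        (x , s<x , x<t , s~x , x~t) = apex (≤-<-trans s<p p<t) (≤-trans t≤b′ (<⇒≤ b′<N)) s~t
        t<b = s≤s t≤b′
        (y₂ , a≤y₂ , y₂<s , b~y₂ , y₂~s) =
          previous-neighbour-adjacent (<-trans s<x (<-trans x<t t<b)) b≤N b~s b~a (<-≤-trans a<c c≤s)
        (y₁ , _ , y₁<y₂ , b~y₁ , y₁~y₂) =
          previous-neighbour-adjacent (<-trans y₂<s (<-trans s<x (<-trans x<t t<b))) b≤N b~y₂ b~0
            (<-≤-trans 0<a a≤y₂)
    in fan-ascending y₁<y₂ y₂<s s<x x<t t<b b≤N b~y₁ b~y₂ b~s b~t y₁~y₂ y₂~s s~t s~x (~-sym x~t)
    where
    b′<N = <-≤-trans (n<1+n b′) b≤N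
    b~b′ = ~-sym (boundary-edge b′<N)
    p<b′ = ≤∧≢⇒< (s≤s⁻¹ p<b) λ p≡b′ → ¬b~p (subst (suc b′ ~_) (sym p≡b′) b~b′)

  distant⇒fan-with-ear : ∀ {p} → 0 < p → p ≤ N → ¬ 0 ~ p → (∀ {q} → 0 ~ q → ¬ q ~ p) → FanWithEar
  distant⇒fan-with-ear {p} 0<p p≤N ¬0~p no-common =
    let (a , b , 1≤a , a<p , p<b , b≤N , 0~a , 0~b , a~b) =
          flanking-neighbours z≤n ≤-refl (inj₁ z<s) 1<p p<N (boundary-edge 0<N) (closing-edge 0<N) ¬0~p
        (c , a<c , c<b , a~c , c~b) = apex (≤-<-trans a<p p<b) b≤N a~b
    in case <-cmp p c of λ where
      (tri< p<c _ _) → fan-around-left-corner 1≤a a<p p<c c<b b≤N 0~a 0~b a~b a~c (no-common 0~a)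
      (tri≈ _ p≡c _) → contradiction (subst (a ~_) (sym p≡c) a~c) (no-common 0~a)
      (tri> _ _ c<p) → fan-around-right-corner 1≤a a<c c<p p<b b≤N (~-sym 0~b) (~-sym a~b) (~-sym c~b)
                         (no-common 0~b)
    where
    0<N = <-≤-trans 0<p p≤N
    1<p = ≤∧≢⇒< 0<p λ 1≡p → ¬0~p (subst (0 ~_) 1≡p (boundary-edge 0<N))
    p<N = ≤∧≢⇒< p≤N λ p≡N → ¬0~p (subst (0 ~_) (sym p≡N) (closing-edge 0<N))

Edge-addEdge : ∀ {n} {A : Adj n} {a b x y} → Edge (addEdge A a b) x y →
               Edge A x y ⊎ (x ≡ a × y ≡ b) ⊎ (x ≡ b × y ≡ a)
Edge-addEdge {a = a} {b} {x} {y} e with T-∨ .to (T-≡ .from e)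
... | inj₁ old = inj₁ (T-≡ .to old)
... | inj₂ new = inj₂ (Sum.map (both (x ≟ a) (y ≟ b)) (both (x ≟ b) (y ≟ a)) (T-∨ .to new))
  where
  both : ∀ {P Q : Set} (p? : Dec P) (q? : Dec Q) → T (does p? ∧ does q?) → P × Q
  both (yes p) (yes q) _ = p , q

module OuterplanarLayout
  {N : ℕ} (H : Graph (suc N))
  (σ : Fin (suc N) → Fin (suc N)) (σ-injective : Injective _≡_ _≡_ σ)
  (σ-planar : ∀ a b c d → Edge (adj H) a b → Edge (adj H) c d → ¬ Crossing σ a b c d)
  (maximal : ∀ a b → a ≢ b → adj H a b ≡ false → ¬ OuterplanarAdj (addEdge (adj H) a b))
  (u : Fin (suc N))
  where

  private
    n = suc N

  E : Fin n → Fin n → Set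
  E = Edge (adj H)

  E-sym : ∀ {a b} → E a b → E b a
  E-sym {a} {b} = trans (symm H b a)

  P : Fin n → ℕ
  P a = toℕ (σ a)

  Pu≤n : P u ≤ n
  Pu≤n = <⇒≤ (Fin.toℕ<n (σ u))

  pos : Fin n → ℕ
  pos a = rotate n (P u) (P a)

  pos≤N : ∀ a → pos a ≤ N
  pos≤N a = s≤s⁻¹ (rotate-bounded n Pu≤n (Fin.toℕ<n (σ a)))

  pos-u : pos u ≡ 0
  pos-u = rotate-self n (P u)

  unrotate-pos : ∀ a → rotate n (n ∸ P u) (pos a) ≡ P a
  unrotate-pos a = rotate-inverse n Pu≤n (Fin.toℕ<n (σ a))

  pos-injective : ∀ {a b} → pos a ≡ pos b → a ≡ b
  pos-injective {a} {b} pos-a≡pos-b = σ-injective (Fin.toℕ-injective (begin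
    P a                        ≡⟨ unrotate-pos a ⟨
    rotate n (n ∸ P u) (pos a) ≡⟨ cong (rotate n (n ∸ P u)) pos-a≡pos-b ⟩
    rotate n (n ∸ P u) (pos b) ≡⟨ unrotate-pos b ⟩
    P b                        ∎))
    where open ≡-Reasoning

  pos-surjective : ∀ {i} → i ≤ N → ∃ λ a → pos a ≡ i
  pos-surjective {i} i≤N =
    let (a , σa≡j) = injective⇒surjective σ-injective (fromℕ< j<n)
    in a , (begin
      rotate n (P u) (toℕ (σ a))            ≡⟨ cong (rotate n (P u) ∘ toℕ) σa≡j ⟩
      rotate n (P u) (toℕ (fromℕ< j<n))      ≡⟨ cong (rotate n (P u)) (Fin.toℕ-fromℕ< j<n) ⟩
      rotate n (P u) (rotate n (n ∸ P u) i)  ≡⟨ rotate-inverse′ n Pu≤n (s≤s i≤N) ⟩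
      i                                      ∎)
    where
    open ≡-Reasoning
    j<n : rotate n (n ∸ P u) i < n
    j<n = rotate-bounded n (m∸n≤m n (P u)) (s≤s i≤N)

  -- Positions beyond N are sent to the junk value u.
  at : ℕ → Fin n
  at i with i ≤? N
  ... | yes i≤N = proj₁ (pos-surjective i≤N)
  ... | no _ = u

  pos-at : ∀ {i} → i ≤ N → pos (at i) ≡ i
  pos-at {i} i≤N with i ≤? N
  ... | yes i≤N = proj₂ (pos-surjective i≤N)
  ... | no i≰N = contradiction i≤N i≰N

  at-pos : ∀ a → at (pos a) ≡ a
  at-pos a = pos-injective (pos-at (pos≤N a))

  at-0 : at 0 ≡ u
  at-0 = subst (λ i → at i ≡ u) pos-u (at-pos u)

  cyclic-in-σ : ∀ {a b c d} → Ascending (pos a) (pos b) (pos c) (pos d) → Cyclic (P a) (P b) (P c) (P d)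
  cyclic-in-σ {a} {b} {c} {d} (a<b , b<c , c<d) =
    Cyclic-resp (unrotate-pos a) (unrotate-pos b) (unrotate-pos c) (unrotate-pos d)
      (rotate-cyclic n (n ∸ P u) a<b b<c c<d (s≤s (pos≤N d)))

  cyclic-in-pos : ∀ {a b c d} → Ascending (P a) (P b) (P c) (P d) → Cyclic (pos a) (pos b) (pos c) (pos d)
  cyclic-in-pos {d = d} (a<b , b<c , c<d) = rotate-cyclic n (P u) a<b b<c c<d (Fin.toℕ<n (σ d))

  no-crossing : ∀ {a b c d} → E a b → E c d → ¬ Ascending (pos a) (pos c) (pos b) (pos d)
  no-crossing {a} {b} {c} {d} a~b c~d order with cyclic-in-σ order
  ... | inj₁ acbd = σ-planar a b c d a~b c~d acbd
  ... | inj₂ (inj₁ cbda) = σ-planar c d b a c~d (E-sym a~b) cbda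
  ... | inj₂ (inj₂ (inj₁ bdac)) = σ-planar b a d c (E-sym a~b) (E-sym c~d) bdac
  ... | inj₂ (inj₂ (inj₂ dacb)) = σ-planar d c a b (E-sym c~d) a~b dacb

  Crosses : Fin n → Fin n → Fin n → Fin n → Set
  Crosses a b c d = E c d × pos a < pos c × pos c < pos b × (pos d < pos a ⊎ pos b < pos d)

  crosses? : ∀ a b c d → Dec (Crosses a b c d)
  crosses? a b c d = (adj H c d ≟ᵇ true) ×-dec (pos a <? pos c) ×-dec (pos c <? pos b)
                     ×-dec (pos d <? pos a ⊎-dec pos b <? pos d)

  -- By maximality, otherwise the chord ab could be added to the drawing σ.
  non-edge-crossed : ∀ {a b} → pos a < pos b → ¬ E a b → ∃₂ (Crosses a b)
  non-edge-crossed {a} {b} a<b ¬a~b =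
    decidable-stable (Fin.any? λ c → Fin.any? λ d → crosses? a b c d) λ uncrossed →
      maximal a b (λ { refl → <-irrefl refl a<b }) (¬-not ¬a~b) (σ , σ-injective , planar uncrossed)
    where
    separated : ¬ ∃₂ (Crosses a b) → ∀ {c d} → E c d → ¬ Cyclic (pos a) (pos c) (pos b) (pos d)
    separated uncrossed c~d cyclic = uncrossed (_ , _ , c~d , Cyclic⇒inside cyclic a<b)

    old-or-new : ∀ {x y} → Edge (addEdge (adj H) a b) x y → E x y ⊎ (x ≡ a × y ≡ b) ⊎ (x ≡ b × y ≡ a)
    old-or-new = Edge-addEdge {A = adj H}

    planar : ¬ ∃₂ (Crosses a b) → ∀ p q r t → Edge (addEdge (adj H) a b) p q →
             Edge (addEdge (adj H) a b) r t → ¬ Crossing σ p q r t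
    planar uncrossed p q r t p~q r~t cross with old-or-new p~q | old-or-new r~t
    ... | inj₁ p~q | inj₁ r~t = σ-planar p q r t p~q r~t cross
    ... | inj₂ (inj₁ (refl , refl)) | inj₁ r~t = separated uncrossed r~t (cyclic-in-pos cross)
    ... | inj₂ (inj₂ (refl , refl)) | inj₁ r~t =
      separated uncrossed (E-sym r~t) (Cyclic-rotate (Cyclic-rotate (cyclic-in-pos cross)))
    ... | inj₁ p~q | inj₂ (inj₁ (refl , refl)) =
      separated uncrossed (E-sym p~q) (Cyclic-rotate (cyclic-in-pos cross))
    ... | inj₁ p~q | inj₂ (inj₂ (refl , refl)) =
      separated uncrossed p~q (Cyclic-rotate (Cyclic-rotate (Cyclic-rotate (cyclic-in-pos cross))))
    ... | inj₂ (inj₁ (refl , refl)) | inj₂ (inj₁ (refl , refl)) = <-irrefl refl (proj₁ cross)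
    ... | inj₂ (inj₁ (refl , refl)) | inj₂ (inj₂ (refl , refl)) = <-irrefl refl (proj₁ (proj₂ cross))
    ... | inj₂ (inj₂ (refl , refl)) | inj₂ (inj₁ (refl , refl)) = <-irrefl refl (proj₁ (proj₂ cross))
    ... | inj₂ (inj₂ (refl , refl)) | inj₂ (inj₂ (refl , refl)) = <-irrefl refl (proj₁ cross)

  _~_ : ℕ → ℕ → Set
  i ~ j = E (at i) (at j)

  pos-at-< : ∀ {i j} → i < j → j ≤ N → pos (at i) < pos (at j)
  pos-at-< i<j j≤N = subst₂ _<_ (sym (pos-at (<⇒≤ (<-≤-trans i<j j≤N)))) (sym (pos-at j≤N)) i<j

  ~-non-crossing : ∀ {i k j l} → i < k → k < j → j < l → l ≤ N → i ~ j → ¬ k ~ l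
  ~-non-crossing i<k k<j j<l l≤N i~j k~l =
    no-crossing i~j k~l (pos-at-< i<k k≤N , pos-at-< k<j j≤N , pos-at-< j<l l≤N)
    where
    j≤N = <⇒≤ (<-≤-trans j<l l≤N)
    k≤N = <⇒≤ (<-≤-trans k<j j≤N)

  ~-saturated : ∀ {i j} → i < j → j ≤ N → ¬ i ~ j →
                ∃₂ λ k l → i < k × k < j × (l < i ⊎ j < l) × l ≤ N × k ~ l
  ~-saturated {i} {j} i<j j≤N ¬i~j with non-edge-crossed (pos-at-< i<j j≤N) ¬i~j
  ... | c , d , c~d , i<c , c<j , outside rewrite pos-at (<⇒≤ (<-≤-trans i<j j≤N)) | pos-at j≤N =
    pos c , pos d , i<c , c<j , outside , pos≤N d , subst₂ E (sym (at-pos c)) (sym (at-pos d)) c~d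

  _~?_ : ∀ i j → Dec (i ~ j)
  i ~? j = adj H (at i) (at j) ≟ᵇ true

  open TriangulatedPolygon N _~_ _~?_ E-sym ~-non-crossing ~-saturated public

FalseTwinFree : ∀ {m} → Graph m → Set
FalseTwinFree H = ∀ i j → (∀ k → adj H i k ≡ adj H j k) → i ≡ j

G62-false-twin-free : FalseTwinFree G62
G62-false-twin-free i j same with separated i j
  where
  separated : ∀ i j → i ≡ j ⊎ ∃ λ k → adj G62 i k ≢ adj G62 j k
  separated = from-yes (Fin.all? λ i → Fin.all? λ j →
    (i ≟ j) ⊎-dec Fin.any? λ k → ¬? (adj G62 i k ≟ᵇ adj G62 j k))
... | inj₁ i≡j = i≡j
... | inj₂ (k , differ) = contradiction (same k) differ

-- The hypothesis is phrased with _<ᵇ_ so that, for concrete vertices of H, the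
-- pairs that are not increasing need no clauses.
induced-copy : ∀ {n m} (G : Graph n) (H : Graph m) (f : Fin m → Fin n) → FalseTwinFree H →
               (∀ {i j} → T (toℕ i <ᵇ toℕ j) → adj G (f i) (f j) ≡ adj H i j) →
               HasInducedCopy G H
induced-copy G H f twin-free upper = f , injective , copy
  where
  copy : ∀ i j → adj G (f i) (f j) ≡ adj H i j
  copy i j with Fin.<-cmp i j
  ... | tri< i<j _ _ = upper (<⇒<ᵇ i<j)
  ... | tri≈ _ refl _ = trans (irrefl G (f i)) (sym (irrefl H i))
  ... | tri> _ _ j<i = trans (symm G (f i) (f j)) (trans (upper (<⇒<ᵇ j<i)) (symm H j i))

  injective : Injective _≡_ _≡_ f
  injective {i} {j} fi≡fj = twin-free i j λ k →
    trans (sym (copy i k)) (trans (cong (λ a → adj G a (f k)) fi≡fj) (copy j k))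

distant-pair⇒G62 : ∀ {n} (H : Graph n) → MaximalOuterplanar H → ∀ u v → ¬ DistLe H u v 2 →
                   HasInducedCopy H G62
distant-pair⇒G62 {suc N} H ((σ , σ-injective , σ-planar) , maximal) u v far =
  induced-copy H G62 (at ∘ vertex) G62-false-twin-free (λ {i} {j} → upper {i} {j})
  where
  open OuterplanarLayout H σ σ-injective σ-planar maximal u

  from-u : ∀ {b} → E (at 0) b → E u b
  from-u = subst (λ a → E a _) at-0

  to-v : ∀ {a} → E a (at (pos v)) → E a v
  to-v = subst (E _) (at-pos v)

  0<pos-v : 0 < pos v
  0<pos-v = n≢0⇒n>0 λ pos-v≡0 →
    let u≡v = pos-injective (trans pos-u (sym pos-v≡0))
    in far (0 , z≤n , subst (λ a → Walk (adj H) u a 0) u≡v (here tt))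

  ¬0~v : ¬ 0 ~ pos v
  ¬0~v 0~v = far (1 , s≤s z≤n , step tt (from-u (to-v 0~v)) (here tt))

  no-common : ∀ {q} → 0 ~ q → ¬ q ~ pos v
  no-common 0~q q~v = far (2 , ≤-refl , step tt (from-u 0~q) (step tt (to-v q~v) (here tt)))

  fan : FanWithEar
  fan = distant⇒fan-with-ear 0<pos-v (pos≤N v) ¬0~v (λ {q} → no-common {q})

  open FanWithEar fan

  vertex : Fin 6 → ℕ
  vertex zero = w
  vertex (suc zero) = y₁
  vertex (suc (suc zero)) = y₂
  vertex (suc (suc (suc zero))) = y₃
  vertex (suc (suc (suc (suc zero)))) = y₄
  vertex (suc (suc (suc (suc (suc zero))))) = x

  upper : ∀ {i j} → T (toℕ i <ᵇ toℕ j) → adj H (at (vertex i)) (at (vertex j)) ≡ adj G62 i j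
  upper {zero} {suc zero} _ = w~y₁
  upper {zero} {suc (suc zero)} _ = w~y₂
  upper {zero} {suc (suc (suc zero))} _ = w~y₃
  upper {zero} {suc (suc (suc (suc zero)))} _ = w~y₄
  upper {zero} {suc (suc (suc (suc (suc zero))))} _ = ¬-not w≁x
  upper {suc zero} {suc (suc zero)} _ = y₁~y₂
  upper {suc zero} {suc (suc (suc zero))} _ = ¬-not y₁≁y₃
  upper {suc zero} {suc (suc (suc (suc zero)))} _ = ¬-not y₁≁y₄
  upper {suc zero} {suc (suc (suc (suc (suc zero))))} _ = ¬-not y₁≁x
  upper {suc (suc zero)} {suc (suc (suc zero))} _ = y₂~y₃
  upper {suc (suc zero)} {suc (suc (suc (suc zero)))} _ = ¬-not y₂≁y₄
  upper {suc (suc zero)} {suc (suc (suc (suc (suc zero))))} _ = ¬-not y₂≁x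
  upper {suc (suc (suc zero))} {suc (suc (suc (suc zero)))} _ = y₃~y₄
  upper {suc (suc (suc zero))} {suc (suc (suc (suc (suc zero))))} _ = y₃~x
  upper {suc (suc (suc (suc zero)))} {suc (suc (suc (suc (suc zero))))} _ = y₄~x

theorem3p2 : (n : ℕ) (H : Graph n) → TwoConnected H → MaximalOuterplanar H → Diameter3 H →
    HasInducedCopy H G61 ⊎ HasInducedCopy H G62
theorem3p2 n H _ mop (_ , _ , u , v , far) = inj₂ (distant-pair⇒G62 H mop u v far)
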